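{- Let $n$ be even, let $f_1$ be a homogeneous cubic bent function on $\mathbb{F}_2^n$, and let $q_2,q_3$ be homogeneous quadratic Boolean functions on $\mathbb{F}_2^n$ such that $f_2=f_1+q_2$ and $f_3=f_1+q_3$ are bent and $f_1+f_2+f_3$ is bent. Let $s$ be a Boolean function on $\mathbb{F}_2^n$ and $f_4=f_1+f_2+f_3+s$. Then $f=f_1\|f_2\|f_3\|f_4$ is a homogeneous cubic bent function on $\mathbb{F}_2^{n+2}$ if and only if $s$ is a linear function (i.e., $s(z)=a\cdot z$ for some $a\in\mathbb{F}_2^n$) and $f_1^*+f_2^*+f_3^*=(f_1+f_2+f_3+s)^*+1$.
   Context: A Boolean function is homogeneous cubic (resp. quadratic) if all monomials in its algebraic normal form have degree 3 (resp. 2). A Boolean function $g$ on $\mathbb{F}_2^N$ ($N$ even) is bent if $W_g(u)=\sum_z(-1)^{g(z)+u\cdot z}=\pm2^{N/2}$ for all $u$; its dual $g^*$ is defined by $W_g(u)=2^{N/2}(-1)^{g^*(u)}$. For $g_1,\dots,g_4$ on $\mathbb{F}_2^n$, $g_1\|g_2\|g_3\|g_4$ is the function $(z,z_{n+1},z_{n+2})\mapsto g_1(z)+z_{n+1}(g_1+g_3)(z)+z_{n+2}(g_1+g_2)(z)+z_{n+1}z_{n+2}(g_1+g_2+g_3+g_4)(z)$ on $\mathbb{F}_2^{n+2}$. -}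

module Defs where

open import Data.Bool using (Bool; true; false; _∧_; _xor_; not; if_then_else_)
open import Data.Nat using (ℕ; zero; suc; _+_; ⌊_/2⌋; _^_)
open import Data.Integer as ℤ using (ℤ; +_; -_)
open import Data.Vec using (Vec; []; _∷_; take; drop; lookup; zipWith)
open import Data.List using (List; []; _∷_; map; _++_; foldr; filter)
open import Data.Fin using (Fin; zero; suc)
open import Data.Product using (∃; _×_)
open import Relation.Binary.PropositionalEquality using (_≡_)
open import Data.Sum using (_⊎_)

-- Boolean functions on F_2^n; vectors of F_2^n are Vec Bool n (true = 1).
BF : ℕ → Set
BF n = Vec Bool n → Bool

allVecs : (n : ℕ) → List (Vec Bool n)
allVecs zero = [] ∷ []
allVecs (suc n) = map (false ∷_) (allVecs n) ++ map (true ∷_) (allVecs n)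

xorSum : List Bool → Bool
xorSum = foldr _xor_ false

ℤsum : List ℤ → ℤ
ℤsum = foldr ℤ._+_ (+ 0)

_⊕_ : ∀ {n} → BF n → BF n → BF n
(f ⊕ g) z = f z xor g z
infixl 6 _⊕_

_·_ : ∀ {n} → Vec Bool n → Vec Bool n → Bool
[] · [] = false
(a ∷ u) · (b ∷ z) = (a ∧ b) xor (u · z)

_≼_ : ∀ {n} → Vec Bool n → Vec Bool n → Bool
[] ≼ [] = true
(a ∷ v) ≼ (b ∷ u) = (if a then b else true) ∧ (v ≼ u)

wt : ∀ {n} → Vec Bool n → ℕ
wt [] = 0
wt (true ∷ v) = suc (wt v)
wt (false ∷ v) = wt v

-- ANF coefficient of the monomial x^u (binary Möbius transform)
anf : ∀ {n} → BF n → Vec Bool n → Bool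
anf {n} f u = xorSum (map (λ v → (v ≼ u) ∧ f v) (allVecs n))

Homogeneous : ∀ {n} → ℕ → BF n → Set
Homogeneous {n} d f = ∀ (u : Vec Bool n) → anf f u ≡ true → wt u ≡ d

HomCubic : ∀ {n} → BF n → Set
HomCubic = Homogeneous 3

HomQuadratic : ∀ {n} → BF n → Set
HomQuadratic = Homogeneous 2

sgn : Bool → ℤ
sgn false = + 1
sgn true = - (+ 1)

walsh : ∀ {n} → BF n → Vec Bool n → ℤ
walsh {n} g u = ℤsum (map (λ z → sgn (g z xor (u · z))) (allVecs n))

Bent : ∀ {n} → BF n → Set
Bent {n} g = ∀ (u : Vec Bool n) →
  (walsh g u ≡ + (2 ^ ⌊ n /2⌋)) ⊎ (walsh g u ≡ - (+ (2 ^ ⌊ n /2⌋)))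

-- dual g*(u): W_g(u) = 2^{n/2} (-1)^{g*(u)}, i.e. g*(u) = 1 iff W_g(u) < 0
-- (meaningful for bent g)
dual : ∀ {n} → BF n → BF n
dual g u with walsh g u
... | + _ = false
... | ℤ.-[1+ _ ] = true

Linear : ∀ {n} → BF n → Set
Linear {n} s = ∃ λ (a : Vec Bool n) → ∀ (z : Vec Bool n) → s z ≡ a · z

-- concatenation g1 || g2 || g3 || g4 on F_2^{n+2}; the point is (z, z_{n+1}, z_{n+2})
conc : ∀ {n} → BF n → BF n → BF n → BF n → BF (n + 2)
conc {n} g₁ g₂ g₃ g₄ w =
  g₁ z xor (x₁ ∧ (g₁ z xor g₃ z)) xor (x₂ ∧ (g₁ z xor g₂ z))
       xor (x₁ ∧ x₂ ∧ (g₁ z xor g₂ z xor g₃ z xor g₄ z))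
  where
  z : Vec Bool n
  z = take n w
  x₁ : Bool
  x₁ = lookup (drop n w) zero
  x₂ : Bool
  x₂ = lookup (drop n w) (suc zero)

-- The ANF of f₁ ‖ f₂ ‖ f₃ ‖ f₄ at (u , x) is the ANF at u of f₁, f₁ + f₂, f₁ + f₃ or
-- f₁ + f₂ + f₃ + f₄ according to the corner x ∈ F₂², so for f₁ cubic and q₂, q₃ quadratic
-- the concatenation is homogeneous cubic iff s is homogeneous of degree 1, i.e. linear.
-- Its Walsh transform at (u , v) is Σₓ (-1)^{v·x} W_{fₓ}(u).  Once s is linear all four fᵢ
-- are bent, and this is 2^{n/2} times the Walsh transform at v of the two-variable function
-- x ↦ fₓ*(u); so the concatenation is bent iff each of these is bent, which for two
-- variables means odd weight: f₁* + f₂* + f₃* + f₄* = 1.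
module Submission where

open import Defs
open import Algebra.Bundles using (CommutativeMonoid; CommutativeRing)
open import Algebra.Structures using (IsCommutativeMonoid)
import Algebra.Properties.CommutativeSemigroup as CommutativeSemigroupProperties
open import Data.Bool using (Bool; true; false; _∧_; _xor_; not)
open import Data.Bool.Properties
  using (xor-assoc; xor-comm; xor-same; xor-identityʳ; ∧-zeroʳ; ∧-identityʳ;
         ∧-distribˡ-xor; ∧-distribʳ-xor; ¬-not; xor-∧-commutativeRing)
open import Data.Integer as ℤ using (ℤ; +_; -_)
import Data.Integer.Properties as ℤₚ
open import Data.List as List using (List; []; _∷_; map)
open import Data.List.Properties using (map-++; map-∘)
open import Data.Nat using (ℕ; zero; suc; _*_; _+_; _^_; ⌊_/2⌋; NonZero)
import Data.Nat.Properties as ℕₚ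
open import Data.Product using (_×_; _,_; ∃)
open import Data.Sum using (_⊎_; inj₁; inj₂; [_,_])
import Data.Sum as Sum
open import Data.Vec using (Vec; []; _∷_; _++_; take; drop; zipWith)
open import Data.Vec.Properties using (take++drop≡id)
open import Function using (_∘_)
open import Function.Bundles using (_⇔_; mk⇔; module Equivalence)
open import Level using (0ℓ)
open import Relation.Binary.PropositionalEquality
  using (_≡_; refl; sym; trans; cong; cong₂; subst; module ≡-Reasoning)
open import Relation.Nullary using (contradiction)

open Equivalence using (to; from)
open ≡-Reasoning

module FiniteSum {A : Set} {_∙_ : A → A → A} {ε : A}
                 (isCommutativeMonoid : IsCommutativeMonoid _≡_ _∙_ ε) where

  open IsCommutativeMonoid isCommutativeMonoid using (assoc; identityˡ; identityʳ)
  commutativeMonoid : CommutativeMonoid 0ℓ 0ℓ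
  commutativeMonoid = record { isCommutativeMonoid = isCommutativeMonoid }

  open CommutativeSemigroupProperties (CommutativeMonoid.commutativeSemigroup commutativeMonoid)
    using (interchange)

  Σ : List A → A
  Σ = List.foldr _∙_ ε

  Σ-++ : ∀ xs ys → Σ (xs List.++ ys) ≡ (Σ xs ∙ Σ ys)
  Σ-++ []       ys = sym (identityˡ _)
  Σ-++ (x ∷ xs) ys = trans (cong (x ∙_) (Σ-++ xs ys)) (sym (assoc x _ _))

  Σ-cong : ∀ {B : Set} {f g : B → A} → (∀ x → f x ≡ g x) → ∀ xs → Σ (map f xs) ≡ Σ (map g xs)
  Σ-cong f≗g []       = refl
  Σ-cong f≗g (x ∷ xs) = cong₂ _∙_ (f≗g x) (Σ-cong f≗g xs)

  Σ-∙ : ∀ {B : Set} (f g : B → A) xs → Σ (map (λ x → f x ∙ g x) xs) ≡ (Σ (map f xs) ∙ Σ (map g xs))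
  Σ-∙ f g []       = sym (identityˡ ε)
  Σ-∙ f g (x ∷ xs) = trans (cong ((f x ∙ g x) ∙_) (Σ-∙ f g xs)) (interchange _ _ _ _)

  Σ-ε : ∀ {B : Set} (xs : List B) → Σ (map (λ _ → ε) xs) ≡ ε
  Σ-ε []       = refl
  Σ-ε (x ∷ xs) = trans (cong (ε ∙_) (Σ-ε xs)) (identityˡ ε)

  Σ-swap : ∀ {B C : Set} (h : B → C → A) xs ys →
    Σ (map (λ x → Σ (map (h x) ys)) xs) ≡ Σ (map (λ y → Σ (map (λ x → h x y) xs)) ys)
  Σ-swap h []       ys = sym (Σ-ε ys)
  Σ-swap h (x ∷ xs) ys = trans (cong (Σ (map (h x) ys) ∙_) (Σ-swap h xs ys)) (sym (Σ-∙ (h x) _ ys))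

  Σ-allVecs-suc : ∀ {n} (h : Vec Bool (suc n) → A) →
    Σ (map h (allVecs (suc n))) ≡ (Σ (map (h ∘ (false ∷_)) (allVecs n)) ∙ Σ (map (h ∘ (true ∷_)) (allVecs n)))
  Σ-allVecs-suc {n} h = begin
    Σ (map h (map (false ∷_) (allVecs n) List.++ map (true ∷_) (allVecs n)))
      ≡⟨ cong Σ (map-++ h (map (false ∷_) (allVecs n)) (map (true ∷_) (allVecs n))) ⟩
    Σ (map h (map (false ∷_) (allVecs n)) List.++ map h (map (true ∷_) (allVecs n)))
      ≡⟨ Σ-++ (map h (map (false ∷_) (allVecs n))) (map h (map (true ∷_) (allVecs n))) ⟩
    (Σ (map h (map (false ∷_) (allVecs n))) ∙ Σ (map h (map (true ∷_) (allVecs n))))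
      ≡⟨ sym (cong₂ _∙_ (cong Σ (map-∘ (allVecs n))) (cong Σ (map-∘ (allVecs n)))) ⟩
    (Σ (map (h ∘ (false ∷_)) (allVecs n)) ∙ Σ (map (h ∘ (true ∷_)) (allVecs n)))
      ∎

  Σ-allVecs-++ : ∀ m {n} (h : Vec Bool (m + n) → A) →
    Σ (map h (allVecs (m + n))) ≡ Σ (map (λ z → Σ (map (λ x → h (z ++ x)) (allVecs n))) (allVecs m))
  Σ-allVecs-++ zero    h = sym (identityʳ _)
  Σ-allVecs-++ (suc m) {n} h = trans (Σ-allVecs-suc h)
    (trans (cong₂ _∙_ (Σ-allVecs-++ m (h ∘ (false ∷_))) (Σ-allVecs-++ m (h ∘ (true ∷_))))
           (sym (Σ-allVecs-suc (λ z → Σ (map (λ x → h (z ++ x)) (allVecs n))))))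

module XorSum = FiniteSum (CommutativeRing.+-isCommutativeMonoid xor-∧-commutativeRing)
module IntSum = FiniteSum ℤₚ.+-0-isCommutativeMonoid

ℤsum-*ʳ : ∀ {B : Set} (f : B → ℤ) c xs → ℤsum (map (λ x → f x ℤ.* c) xs) ≡ ℤsum (map f xs) ℤ.* c
ℤsum-*ʳ f c []       = refl
ℤsum-*ʳ f c (x ∷ xs) = trans (cong (ℤ._+_ (f x ℤ.* c)) (ℤsum-*ʳ f c xs)) (sym (ℤₚ.*-distribʳ-+ c (f x) _))

sgn-xor : ∀ a b → sgn (a xor b) ≡ sgn a ℤ.* sgn b
sgn-xor false b     = sym (ℤₚ.*-identityˡ (sgn b))
sgn-xor true  false = refl
sgn-xor true  true  = refl

xor-cancelˡ : ∀ a b → a xor (a xor b) ≡ b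
xor-cancelˡ a b = trans (sym (xor-assoc a a b)) (cong (_xor b) (xor-same a))

take-++ : ∀ {A : Set} {m n} (xs : Vec A m) (ys : Vec A n) → take m (xs ++ ys) ≡ xs
take-++ []       ys = refl
take-++ (x ∷ xs) ys = cong (x ∷_) (take-++ xs ys)

drop-++ : ∀ {A : Set} {m n} (xs : Vec A m) (ys : Vec A n) → drop m (xs ++ ys) ≡ ys
drop-++ []       ys = refl
drop-++ (x ∷ xs) ys = drop-++ xs ys

elim-++ : ∀ {A : Set} {m n} {P : Vec A (m + n) → Set} → (∀ u v → P (u ++ v)) → ∀ w → P w
elim-++ {m = m} {P = P} p w = subst P (take++drop≡id m w) (p (take m w) (drop m w))

·-++ : ∀ {m n} (u z : Vec Bool m) (v x : Vec Bool n) → (u ++ v) · (z ++ x) ≡ (u · z) xor (v · x)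
·-++ []      []      v x = refl
·-++ (a ∷ u) (b ∷ z) v x = trans (cong ((a ∧ b) xor_) (·-++ u z v x)) (sym (xor-assoc (a ∧ b) _ _))

·-zipWith-xor : ∀ {n} (a u z : Vec Bool n) → zipWith _xor_ a u · z ≡ (a · z) xor (u · z)
·-zipWith-xor []      []      []      = refl
·-zipWith-xor (α ∷ a) (β ∷ u) (b ∷ z) =
  trans (cong₂ _xor_ (∧-distribʳ-xor b α β) (·-zipWith-xor a u z))
        (xor-interchange (α ∧ b) (β ∧ b) (a · z) (u · z))
  where
  open CommutativeSemigroupProperties (CommutativeRing.+-commutativeSemigroup xor-∧-commutativeRing)
    renaming (interchange to xor-interchange)

wt-++ : ∀ {m n} (u : Vec Bool m) (v : Vec Bool n) → wt (u ++ v) ≡ wt u + wt v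
wt-++ []           v = refl
wt-++ (true ∷ u)   v = cong suc (wt-++ u v)
wt-++ (false ∷ u)  v = wt-++ u v

select : ∀ {A : Set} → Vec Bool 2 → A → A → A → A → A
select (false ∷ false ∷ []) a b c d = a
select (false ∷ true  ∷ []) a b c d = b
select (true  ∷ false ∷ []) a b c d = c
select (true  ∷ true  ∷ []) a b c d = d

select-float : ∀ {A B : Set} (h : A → B) x {a b c d : A} →
  h (select x a b c d) ≡ select x (h a) (h b) (h c) (h d)
select-float h (false ∷ false ∷ []) = refl
select-float h (false ∷ true  ∷ []) = refl
select-float h (true  ∷ false ∷ []) = refl
select-float h (true  ∷ true  ∷ []) = refl

Vec₂-elim : ∀ {P : Vec Bool 2 → Set} →
  P (false ∷ false ∷ []) → P (false ∷ true ∷ []) → P (true ∷ false ∷ []) → P (true ∷ true ∷ []) → ∀ x → P x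
Vec₂-elim p q r s (false ∷ false ∷ []) = p
Vec₂-elim p q r s (false ∷ true  ∷ []) = q
Vec₂-elim p q r s (true  ∷ false ∷ []) = r
Vec₂-elim p q r s (true  ∷ true  ∷ []) = s

conc-++ : ∀ {n} (g₁ g₂ g₃ g₄ : BF n) z x → conc g₁ g₂ g₃ g₄ (z ++ x) ≡ select x (g₁ z) (g₂ z) (g₃ z) (g₄ z)
conc-++ g₁ g₂ g₃ g₄ z (x₁ ∷ x₂ ∷ []) rewrite take-++ z (x₁ ∷ x₂ ∷ []) | drop-++ z (x₁ ∷ x₂ ∷ []) =
  expansion x₁ x₂ (g₁ z) (g₂ z) (g₃ z) (g₄ z)
  where
  expansion : ∀ x₁ x₂ a b c d →
    a xor (x₁ ∧ (a xor c)) xor (x₂ ∧ (a xor b)) xor (x₁ ∧ x₂ ∧ (a xor b xor c xor d))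
      ≡ select (x₁ ∷ x₂ ∷ []) a b c d
  expansion false false a b c d = xor-identityʳ a
  expansion false true  a b c d = trans (cong (a xor_) (xor-identityʳ _)) (xor-cancelˡ a b)
  expansion true  false a b c d = trans (cong (a xor_) (xor-identityʳ _)) (xor-cancelˡ a c)
  expansion true  true  a b c d = begin
    a xor ((a xor c) xor ((a xor b) xor (a xor (b xor (c xor d)))))
      ≡⟨ sym (xor-assoc a (a xor c) _) ⟩
    (a xor (a xor c)) xor ((a xor b) xor (a xor (b xor (c xor d))))
      ≡⟨ cong₂ _xor_ (xor-cancelˡ a c) (cong ((a xor b) xor_) (sym (xor-assoc a b _))) ⟩
    c xor ((a xor b) xor ((a xor b) xor (c xor d)))
      ≡⟨ cong (c xor_) (xor-cancelˡ (a xor b) (c xor d)) ⟩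
    c xor (c xor d)
      ≡⟨ xor-cancelˡ c d ⟩
    d ∎

anf-cong : ∀ {n} {f g : BF n} → (∀ z → f z ≡ g z) → ∀ u → anf f u ≡ anf g u
anf-cong {n} f≗g u = XorSum.Σ-cong (λ v → cong ((v ≼ u) ∧_) (f≗g v)) (allVecs n)

anf-⊕ : ∀ {n} (f g : BF n) u → anf (f ⊕ g) u ≡ anf f u xor anf g u
anf-⊕ {n} f g u =
  trans (XorSum.Σ-cong (λ v → ∧-distribˡ-xor (v ≼ u) (f v) (g v)) (allVecs n)) (XorSum.Σ-∙ _ _ (allVecs n))

anf-false : ∀ {n} u → anf {n} (λ _ → false) u ≡ false
anf-false {n} u = trans (XorSum.Σ-cong (λ v → ∧-zeroʳ (v ≼ u)) (allVecs n)) (XorSum.Σ-ε (allVecs n))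

∂ : ∀ {n} → BF (suc n) → BF n
∂ f z = f (false ∷ z) xor f (true ∷ z)

∂-recover : ∀ {n} (f : BF (suc n)) z → f (true ∷ z) ≡ f (false ∷ z) xor ∂ f z
∂-recover f z = sym (xor-cancelˡ (f (false ∷ z)) (f (true ∷ z)))

anf-false∷ : ∀ {n} (f : BF (suc n)) u → anf f (false ∷ u) ≡ anf (f ∘ (false ∷_)) u
anf-false∷ {n} f u = trans (XorSum.Σ-allVecs-suc (λ v → (v ≼ (false ∷ u)) ∧ f v))
  (trans (cong (anf (f ∘ (false ∷_)) u xor_) (XorSum.Σ-ε (allVecs n))) (xor-identityʳ _))

anf-true∷ : ∀ {n} (f : BF (suc n)) u → anf f (true ∷ u) ≡ anf (∂ f) u
anf-true∷ f u = trans (XorSum.Σ-allVecs-suc (λ v → (v ≼ (true ∷ u)) ∧ f v))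
  (sym (anf-⊕ (f ∘ (false ∷_)) (f ∘ (true ∷_)) u))

anf-++ : ∀ {m n} (h : BF (m + n)) (u : Vec Bool m) (y : Vec Bool n) →
  anf h (u ++ y) ≡ anf (λ z → anf (λ x → h (z ++ x)) y) u
anf-++ h []         y = sym (xor-identityʳ _)
anf-++ h (false ∷ u) y = begin
  anf h (false ∷ u ++ y)                               ≡⟨ anf-false∷ h (u ++ y) ⟩
  anf (h ∘ (false ∷_)) (u ++ y)                        ≡⟨ anf-++ (h ∘ (false ∷_)) u y ⟩
  anf (λ z → anf (λ x → h (false ∷ z ++ x)) y) u       ≡⟨ sym (anf-false∷ _ u) ⟩
  anf (λ z → anf (λ x → h (z ++ x)) y) (false ∷ u)     ∎
anf-++ h (true ∷ u) y = begin
  anf h (true ∷ u ++ y)                                ≡⟨ anf-true∷ h (u ++ y) ⟩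
  anf (∂ h) (u ++ y)                                   ≡⟨ anf-++ (∂ h) u y ⟩
  anf (λ z → anf (λ x → ∂ h (z ++ x)) y) u             ≡⟨ anf-cong (λ z → anf-⊕ _ _ y) u ⟩
  anf (∂ (λ z → anf (λ x → h (z ++ x)) y)) u           ≡⟨ sym (anf-true∷ _ u) ⟩
  anf (λ z → anf (λ x → h (z ++ x)) y) (true ∷ u)      ∎

anf-select : ∀ (a b c d : Bool) y →
  anf (λ x → select x a b c d) y ≡ select y a (a xor b) (a xor c) (((a xor b) xor c) xor d)
anf-select a b c d (false ∷ false ∷ []) = xor-identityʳ a
anf-select a b c d (false ∷ true  ∷ []) = cong (a xor_) (xor-identityʳ b)
anf-select a b c d (true  ∷ false ∷ []) = cong (a xor_) (xor-identityʳ c)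
anf-select a b c d (true  ∷ true  ∷ []) = begin
  a xor (b xor (c xor (d xor false)))   ≡⟨ cong (λ t → a xor (b xor (c xor t))) (xor-identityʳ d) ⟩
  a xor (b xor (c xor d))               ≡⟨ sym (xor-assoc a b _) ⟩
  (a xor b) xor (c xor d)               ≡⟨ sym (xor-assoc (a xor b) c d) ⟩
  ((a xor b) xor c) xor d               ∎

anf-conc : ∀ {n} (g₁ g₂ g₃ g₄ : BF n) u x →
  anf (conc g₁ g₂ g₃ g₄) (u ++ x) ≡ anf (select x g₁ (g₁ ⊕ g₂) (g₁ ⊕ g₃) (g₁ ⊕ g₂ ⊕ g₃ ⊕ g₄)) u
anf-conc g₁ g₂ g₃ g₄ u x = begin
  anf (conc g₁ g₂ g₃ g₄) (u ++ x)
    ≡⟨ anf-++ (conc g₁ g₂ g₃ g₄) u x ⟩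
  anf (λ z → anf (λ y → conc g₁ g₂ g₃ g₄ (z ++ y)) x) u
    ≡⟨ anf-cong (λ z → trans (anf-cong (conc-++ g₁ g₂ g₃ g₄ z) x) (anf-select (g₁ z) (g₂ z) (g₃ z) (g₄ z) x)) u ⟩
  anf (λ z → select x (g₁ z) ((g₁ ⊕ g₂) z) ((g₁ ⊕ g₃) z) ((g₁ ⊕ g₂ ⊕ g₃ ⊕ g₄) z)) u
    ≡⟨ anf-cong (λ z → sym (select-float (λ g → g z) x {g₁} {g₁ ⊕ g₂} {g₁ ⊕ g₃} {g₁ ⊕ g₂ ⊕ g₃ ⊕ g₄})) u ⟩
  anf (select x g₁ (g₁ ⊕ g₂) (g₁ ⊕ g₃) (g₁ ⊕ g₂ ⊕ g₃ ⊕ g₄)) u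
    ∎

homogeneous-cong : ∀ {n d} {f g : BF n} → (∀ z → f z ≡ g z) → Homogeneous d f → Homogeneous d g
homogeneous-cong f≗g hf u e = hf u (trans (anf-cong f≗g u) e)

homogeneous-false∷ : ∀ {n d} {f : BF (suc n)} → Homogeneous d f → Homogeneous d (f ∘ (false ∷_))
homogeneous-false∷ {f = f} hf u e = hf (false ∷ u) (trans (anf-false∷ f u) e)

homogeneous-∂ : ∀ {n d} {f : BF (suc n)} → Homogeneous (suc d) f → Homogeneous d (∂ f)
homogeneous-∂ {f = f} hf u e = ℕₚ.suc-injective (hf (true ∷ u) (trans (anf-true∷ f u) e))

homogeneous-∷ : ∀ {n d} {f : BF (suc n)} →
  Homogeneous (suc d) (f ∘ (false ∷_)) → Homogeneous d (∂ f) → Homogeneous (suc d) f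
homogeneous-∷ {f = f} h₀ h∂ (false ∷ u) e = h₀ u (trans (sym (anf-false∷ f u)) e)
homogeneous-∷ {f = f} h₀ h∂ (true  ∷ u) e = cong suc (h∂ u (trans (sym (anf-true∷ f u)) e))

homogeneous-conc : ∀ {n d} {g₁ g₂ g₃ g₄ : BF n} →
  Homogeneous (2 + d) g₁ → Homogeneous (1 + d) (g₁ ⊕ g₂) → Homogeneous (1 + d) (g₁ ⊕ g₃) →
  Homogeneous d (g₁ ⊕ g₂ ⊕ g₃ ⊕ g₄) → Homogeneous (2 + d) (conc g₁ g₂ g₃ g₄)
homogeneous-conc {n} {d} {g₁} {g₂} {g₃} {g₄} h₁ h₂ h₃ h₄ = elim-++ at
  where
  corner : ∀ u x → anf (select x g₁ (g₁ ⊕ g₂) (g₁ ⊕ g₃) (g₁ ⊕ g₂ ⊕ g₃ ⊕ g₄)) u ≡ true → wt x + wt u ≡ 2 + d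
  corner u (false ∷ false ∷ []) = h₁ u
  corner u (false ∷ true  ∷ []) = cong suc ∘ h₂ u
  corner u (true  ∷ false ∷ []) = cong suc ∘ h₃ u
  corner u (true  ∷ true  ∷ []) = cong (suc ∘ suc) ∘ h₄ u

  at : ∀ u x → anf (conc g₁ g₂ g₃ g₄) (u ++ x) ≡ true → wt (u ++ x) ≡ 2 + d
  at u x e = trans (wt-++ u x)
    (trans (ℕₚ.+-comm (wt u) (wt x)) (corner u x (trans (sym (anf-conc g₁ g₂ g₃ g₄ u x)) e)))

homogeneous-conc⇒corner : ∀ {n d} (g₁ g₂ g₃ g₄ : BF n) →
  Homogeneous (2 + d) (conc g₁ g₂ g₃ g₄) → Homogeneous d (g₁ ⊕ g₂ ⊕ g₃ ⊕ g₄)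
homogeneous-conc⇒corner g₁ g₂ g₃ g₄ hF u e = ℕₚ.+-cancelˡ-≡ 2 _ _ (begin
  2 + wt u                   ≡⟨ ℕₚ.+-comm 2 (wt u) ⟩
  wt u + 2                   ≡⟨ sym (wt-++ u (true ∷ true ∷ [])) ⟩
  wt (u ++ true ∷ true ∷ []) ≡⟨ hF (u ++ true ∷ true ∷ []) (trans (anf-conc g₁ g₂ g₃ g₄ u (true ∷ true ∷ [])) e) ⟩
  2 + _                      ∎)

homogeneous₀-const : ∀ {n} (c : Bool) → Homogeneous {n} 0 (λ _ → c)
homogeneous₀-const {zero}  c []          _ = refl
homogeneous₀-const {suc n} c (false ∷ u) e =
  homogeneous₀-const c u (trans (sym (anf-false∷ (λ _ → c) u)) e)
homogeneous₀-const {suc n} c (true  ∷ u) e = contradiction (trans (sym e) anf≡false) λ ()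
  where
  anf≡false : anf (λ _ → c) (true ∷ u) ≡ false
  anf≡false = trans (anf-true∷ _ u) (trans (anf-cong (λ _ → xor-same c) u) (anf-false u))

homogeneous₁-· : ∀ {n} (a : Vec Bool n) → Homogeneous 1 (a ·_)
homogeneous₁-· []      [] ()
homogeneous₁-· (α ∷ a) =
  homogeneous-∷ (homogeneous-cong restriction (homogeneous₁-· a))
                (homogeneous-cong derivative (homogeneous₀-const α))
  where
  restriction : ∀ z → a · z ≡ (α ∷ a) · (false ∷ z)
  restriction z = cong (_xor (a · z)) (sym (∧-zeroʳ α))

  derivative : ∀ z → α ≡ ∂ ((α ∷ a) ·_) z
  derivative z = sym (begin
    ((α ∧ false) xor (a · z)) xor ((α ∧ true) xor (a · z))
      ≡⟨ cong₂ (λ p q → (p xor (a · z)) xor (q xor (a · z))) (∧-zeroʳ α) (∧-identityʳ α) ⟩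
    (a · z) xor (α xor (a · z))
      ≡⟨ cong ((a · z) xor_) (xor-comm α (a · z)) ⟩
    (a · z) xor ((a · z) xor α)
      ≡⟨ xor-cancelˡ (a · z) α ⟩
    α ∎)

linear⇒homogeneous₁ : ∀ {n} {s : BF n} → Linear s → Homogeneous 1 s
linear⇒homogeneous₁ (a , s≗a·) = homogeneous-cong (λ z → sym (s≗a· z)) (homogeneous₁-· a)

anf-vanishing : ∀ {n} {g : BF n} → (∀ u → anf g u ≡ false) → ∀ z → g z ≡ false
anf-vanishing {zero}      anf≗0 [] = trans (sym (xor-identityʳ _)) (anf≗0 [])
anf-vanishing {suc n} {g} anf≗0 z  = vanishing z
  where
  restriction : ∀ z → g (false ∷ z) ≡ false
  restriction = anf-vanishing (λ u → trans (sym (anf-false∷ g u)) (anf≗0 (false ∷ u)))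

  derivative : ∀ z → ∂ g z ≡ false
  derivative = anf-vanishing (λ u → trans (sym (anf-true∷ g u)) (anf≗0 (true ∷ u)))

  vanishing : ∀ z → g z ≡ false
  vanishing (false ∷ z) = restriction z
  vanishing (true  ∷ z) = trans (∂-recover g z) (cong₂ _xor_ (restriction z) (derivative z))

homogeneous₀-∂ : ∀ {n} {f : BF (suc n)} → Homogeneous 0 f → ∀ z → ∂ f z ≡ false
homogeneous₀-∂ {f = f} hf =
  anf-vanishing (λ u → ¬-not (λ e → ℕₚ.1+n≢0 (hf (true ∷ u) (trans (anf-true∷ f u) e))))

homogeneous₀⇒const : ∀ {n} {f : BF n} → Homogeneous 0 f → ∃ λ c → ∀ z → f z ≡ c
homogeneous₀⇒const {zero}  {f} _  = f [] , λ { [] → refl }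
homogeneous₀⇒const {suc n} {f} hf with homogeneous₀⇒const (homogeneous-false∷ hf)
... | c , f₀≗c = c , λ where
  (false ∷ z) → f₀≗c z
  (true  ∷ z) → trans (∂-recover f z)
                  (trans (cong₂ _xor_ (f₀≗c z) (homogeneous₀-∂ hf z)) (xor-identityʳ c))

homogeneous₁⇒linear : ∀ {n} {s : BF n} → Homogeneous 1 s → Linear s
homogeneous₁⇒linear {zero}  {s} hs =
  [] , λ { [] → anf-vanishing {g = s} (λ { [] → ¬-not (λ e → ℕₚ.0≢1+n (hs [] e)) }) [] }
homogeneous₁⇒linear {suc n} {s} hs
  with homogeneous₁⇒linear (homogeneous-false∷ hs) | homogeneous₀⇒const (homogeneous-∂ hs)
... | a , s₀≗a· | c , ∂s≗c = c ∷ a , λ where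
  (false ∷ z) → trans (s₀≗a· z) (cong (_xor (a · z)) (sym (∧-zeroʳ c)))
  (true  ∷ z) → begin
    s (true ∷ z)                 ≡⟨ ∂-recover s z ⟩
    s (false ∷ z) xor ∂ s z      ≡⟨ cong₂ _xor_ (s₀≗a· z) (∂s≗c z) ⟩
    (a · z) xor c                ≡⟨ xor-comm (a · z) c ⟩
    c xor (a · z)                ≡⟨ cong (_xor (a · z)) (sym (∧-identityʳ c)) ⟩
    (c ∧ true) xor (a · z)       ∎

infix 4 _≡±_

_≡±_ : ℤ → ℕ → Set
w ≡± k = (w ≡ + k) ⊎ (w ≡ - (+ k))

≡±-*-cancelʳ : ∀ {w} k c .{{_ : NonZero c}} → (w ℤ.* + c) ≡± (k * c) ⇔ w ≡± k
≡±-*-cancelʳ {w} k c = mk⇔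
  (Sum.map (λ e → ℤₚ.*-cancelʳ-≡ w (+ k) (+ c) (trans e (ℤₚ.pos-* k c)))
           (λ e → ℤₚ.*-cancelʳ-≡ w (- (+ k)) (+ c) (trans e (-k*c≡ k c))))
  (Sum.map (λ e → trans (cong (ℤ._* + c) e) (sym (ℤₚ.pos-* k c)))
           (λ e → trans (cong (ℤ._* + c) e) (sym (-k*c≡ k c))))
  where
  -k*c≡ : ∀ k c → - (+ (k * c)) ≡ - (+ k) ℤ.* + c
  -k*c≡ k c = trans (cong -_ (ℤₚ.pos-* k c)) (ℤₚ.neg-distribˡ-* (+ k) (+ c))

isNegative : ℤ → Bool
isNegative (+ _)      = false
isNegative ℤ.-[1+ _ ] = true

dual≡isNegative : ∀ {n} (g : BF n) u → dual g u ≡ isNegative (walsh g u)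
dual≡isNegative g u with walsh g u
... | + _      = refl
... | ℤ.-[1+ _ ] = refl

≡±⇒≡sgn : ∀ {w} k .{{_ : NonZero k}} → w ≡± k → w ≡ sgn (isNegative w) ℤ.* + k
≡±⇒≡sgn (suc k) (inj₁ refl) = sym (ℤₚ.*-identityˡ _)
≡±⇒≡sgn (suc k) (inj₂ refl) = sym (ℤₚ.-1*i≡-i _)

walsh≡sgn-dual : ∀ {n} {g : BF n} → Bent g → ∀ u → walsh g u ≡ sgn (dual g u) ℤ.* + 2 ^ ⌊ n /2⌋
walsh≡sgn-dual {n} {g} bent u =
  trans (≡±⇒≡sgn (2 ^ ⌊ n /2⌋) {{ℕₚ.m^n≢0 2 ⌊ n /2⌋}} (bent u))
        (cong (λ b → sgn b ℤ.* + 2 ^ ⌊ n /2⌋) (sym (dual≡isNegative g u)))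

walsh-cong : ∀ {n} {f g : BF n} → (∀ z → f z ≡ g z) → ∀ u → walsh f u ≡ walsh g u
walsh-cong {n} f≗g u = IntSum.Σ-cong (λ z → cong (λ b → sgn (b xor (u · z))) (f≗g z)) (allVecs n)

walsh-⊕-· : ∀ {n} (h : BF n) (a u : Vec Bool n) → walsh (h ⊕ (a ·_)) u ≡ walsh h (zipWith _xor_ a u)
walsh-⊕-· {n} h a u = IntSum.Σ-cong shift (allVecs n)
  where
  shift : ∀ z → sgn ((h z xor (a · z)) xor (u · z)) ≡ sgn (h z xor (zipWith _xor_ a u · z))
  shift z = cong sgn (trans (xor-assoc (h z) (a · z) (u · z)) (cong (h z xor_) (sym (·-zipWith-xor a u z))))

bent-⊕-linear : ∀ {n} {h s : BF n} → Bent h → Linear s → Bent (h ⊕ s)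
bent-⊕-linear {h = h} {s} bent (a , s≗a·) u = subst (_≡± _) (sym walsh-shift) (bent (zipWith _xor_ a u))
  where
  walsh-shift : walsh (h ⊕ s) u ≡ walsh h (zipWith _xor_ a u)
  walsh-shift = trans (walsh-cong (λ z → cong (h z xor_) (s≗a· z)) u) (walsh-⊕-· h a u)

walsh-conc : ∀ {n} (g₁ g₂ g₃ g₄ : BF n) u v →
  walsh (conc g₁ g₂ g₃ g₄) (u ++ v) ≡ ℤsum (map (λ x → walsh (select x g₁ g₂ g₃ g₄) u ℤ.* sgn (v · x)) (allVecs 2))
walsh-conc {n} g₁ g₂ g₃ g₄ u v = begin
  walsh (conc g₁ g₂ g₃ g₄) (u ++ v)
    ≡⟨ IntSum.Σ-allVecs-++ n _ ⟩
  ℤsum (map (λ z → ℤsum (map (λ x → sgn (conc g₁ g₂ g₃ g₄ (z ++ x) xor ((u ++ v) · (z ++ x)))) (allVecs 2))) (allVecs n))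
    ≡⟨ IntSum.Σ-cong (λ z → IntSum.Σ-cong (summand z) (allVecs 2)) (allVecs n) ⟩
  ℤsum (map (λ z → ℤsum (map (λ x → term x z) (allVecs 2))) (allVecs n))
    ≡⟨ IntSum.Σ-swap (λ z x → term x z) (allVecs n) (allVecs 2) ⟩
  ℤsum (map (λ x → ℤsum (map (term x) (allVecs n))) (allVecs 2))
    ≡⟨ IntSum.Σ-cong (λ x → ℤsum-*ʳ (λ z → sgn (select x g₁ g₂ g₃ g₄ z xor (u · z))) (sgn (v · x)) (allVecs n))
                     (allVecs 2) ⟩
  ℤsum (map (λ x → walsh (select x g₁ g₂ g₃ g₄) u ℤ.* sgn (v · x)) (allVecs 2))
    ∎
  where
  term : Vec Bool 2 → Vec Bool n → ℤ
  term x z = sgn (select x g₁ g₂ g₃ g₄ z xor (u · z)) ℤ.* sgn (v · x)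

  summand : ∀ z x → sgn (conc g₁ g₂ g₃ g₄ (z ++ x) xor ((u ++ v) · (z ++ x))) ≡ term x z
  summand z x = begin
    sgn (conc g₁ g₂ g₃ g₄ (z ++ x) xor ((u ++ v) · (z ++ x)))
      ≡⟨ cong sgn (cong₂ _xor_ (trans (conc-++ g₁ g₂ g₃ g₄ z x) (sym (select-float (λ g → g z) x {g₁} {g₂} {g₃} {g₄})))
                               (·-++ u z v x)) ⟩
    sgn (select x g₁ g₂ g₃ g₄ z xor ((u · z) xor (v · x)))
      ≡⟨ cong sgn (sym (xor-assoc (select x g₁ g₂ g₃ g₄ z) (u · z) (v · x))) ⟩
    sgn ((select x g₁ g₂ g₃ g₄ z xor (u · z)) xor (v · x))
      ≡⟨ sgn-xor (select x g₁ g₂ g₃ g₄ z xor (u · z)) (v · x) ⟩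
    term x z ∎

duals : ∀ {n} → BF n → BF n → BF n → BF n → Vec Bool n → BF 2
duals g₁ g₂ g₃ g₄ u x = select x (dual g₁ u) (dual g₂ u) (dual g₃ u) (dual g₄ u)

walsh-conc-bent : ∀ {n} {g₁ g₂ g₃ g₄ : BF n} → Bent g₁ → Bent g₂ → Bent g₃ → Bent g₄ → ∀ u v →
  walsh (conc g₁ g₂ g₃ g₄) (u ++ v) ≡ walsh (duals g₁ g₂ g₃ g₄ u) v ℤ.* + 2 ^ ⌊ n /2⌋
walsh-conc-bent {n} {g₁} {g₂} {g₃} {g₄} b₁ b₂ b₃ b₄ u v = begin
  walsh (conc g₁ g₂ g₃ g₄) (u ++ v)
    ≡⟨ walsh-conc g₁ g₂ g₃ g₄ u v ⟩
  ℤsum (map (λ x → walsh (select x g₁ g₂ g₃ g₄) u ℤ.* sgn (v · x)) (allVecs 2))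
    ≡⟨ IntSum.Σ-cong term (allVecs 2) ⟩
  ℤsum (map (λ x → sgn (duals g₁ g₂ g₃ g₄ u x xor (v · x)) ℤ.* P) (allVecs 2))
    ≡⟨ ℤsum-*ʳ (λ x → sgn (duals g₁ g₂ g₃ g₄ u x xor (v · x))) P (allVecs 2) ⟩
  walsh (duals g₁ g₂ g₃ g₄ u) v ℤ.* P
    ∎
  where
  open CommutativeSemigroupProperties ℤₚ.*-commutativeSemigroup using (xy∙z≈xz∙y)

  P : ℤ
  P = + 2 ^ ⌊ n /2⌋

  bentₓ : ∀ x → Bent (select x g₁ g₂ g₃ g₄)
  bentₓ = Vec₂-elim b₁ b₂ b₃ b₄

  term : ∀ x → walsh (select x g₁ g₂ g₃ g₄) u ℤ.* sgn (v · x) ≡ sgn (duals g₁ g₂ g₃ g₄ u x xor (v · x)) ℤ.* P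
  term x = begin
    walsh (select x g₁ g₂ g₃ g₄) u ℤ.* sgn (v · x)
      ≡⟨ cong (ℤ._* sgn (v · x)) (walsh≡sgn-dual {g = select x g₁ g₂ g₃ g₄} (bentₓ x) u) ⟩
    sgn (dual (select x g₁ g₂ g₃ g₄) u) ℤ.* P ℤ.* sgn (v · x)
      ≡⟨ xy∙z≈xz∙y (sgn (dual (select x g₁ g₂ g₃ g₄) u)) P (sgn (v · x)) ⟩
    sgn (dual (select x g₁ g₂ g₃ g₄) u) ℤ.* sgn (v · x) ℤ.* P
      ≡⟨ cong (ℤ._* P) (sym (sgn-xor (dual (select x g₁ g₂ g₃ g₄) u) (v · x))) ⟩
    sgn (dual (select x g₁ g₂ g₃ g₄) u xor (v · x)) ℤ.* P
      ≡⟨ cong (λ b → sgn (b xor (v · x)) ℤ.* P) (select-float (λ g → dual g u) x {g₁} {g₂} {g₃} {g₄}) ⟩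
    sgn (duals g₁ g₂ g₃ g₄ u x xor (v · x)) ℤ.* P
      ∎

-- The right-hand side says that the table a b c d has odd weight.
bent-select⇔ : ∀ a b c d → Bent (λ x → select x a b c d) ⇔ (a xor b xor c ≡ not d)
bent-select⇔ false false false false = mk⇔ (λ bent → [ (λ ()) , (λ ()) ] (bent (false ∷ false ∷ []))) (λ ())
bent-select⇔ false false false true  = mk⇔ (λ _ → refl) (λ _ → Vec₂-elim (inj₁ refl) (inj₁ refl) (inj₁ refl) (inj₂ refl))
bent-select⇔ false false true  false = mk⇔ (λ _ → refl) (λ _ → Vec₂-elim (inj₁ refl) (inj₂ refl) (inj₁ refl) (inj₁ refl))
bent-select⇔ false false true  true  = mk⇔ (λ bent → [ (λ ()) , (λ ()) ] (bent (false ∷ false ∷ []))) (λ ())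
bent-select⇔ false true  false false = mk⇔ (λ _ → refl) (λ _ → Vec₂-elim (inj₁ refl) (inj₁ refl) (inj₂ refl) (inj₁ refl))
bent-select⇔ false true  false true  = mk⇔ (λ bent → [ (λ ()) , (λ ()) ] (bent (false ∷ false ∷ []))) (λ ())
bent-select⇔ false true  true  false = mk⇔ (λ bent → [ (λ ()) , (λ ()) ] (bent (false ∷ false ∷ []))) (λ ())
bent-select⇔ false true  true  true  = mk⇔ (λ _ → refl) (λ _ → Vec₂-elim (inj₂ refl) (inj₁ refl) (inj₁ refl) (inj₁ refl))
bent-select⇔ true  false false false = mk⇔ (λ _ → refl) (λ _ → Vec₂-elim (inj₁ refl) (inj₂ refl) (inj₂ refl) (inj₂ refl))
bent-select⇔ true  false false true  = mk⇔ (λ bent → [ (λ ()) , (λ ()) ] (bent (false ∷ false ∷ []))) (λ ())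
bent-select⇔ true  false true  false = mk⇔ (λ bent → [ (λ ()) , (λ ()) ] (bent (false ∷ false ∷ []))) (λ ())
bent-select⇔ true  false true  true  = mk⇔ (λ _ → refl) (λ _ → Vec₂-elim (inj₂ refl) (inj₂ refl) (inj₁ refl) (inj₂ refl))
bent-select⇔ true  true  false false = mk⇔ (λ bent → [ (λ ()) , (λ ()) ] (bent (false ∷ false ∷ []))) (λ ())
bent-select⇔ true  true  false true  = mk⇔ (λ _ → refl) (λ _ → Vec₂-elim (inj₂ refl) (inj₁ refl) (inj₂ refl) (inj₂ refl))
bent-select⇔ true  true  true  false = mk⇔ (λ _ → refl) (λ _ → Vec₂-elim (inj₂ refl) (inj₂ refl) (inj₂ refl) (inj₁ refl))
bent-select⇔ true  true  true  true  = mk⇔ (λ bent → [ (λ ()) , (λ ()) ] (bent (false ∷ false ∷ []))) (λ ())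

⌊n+2/2⌋ : ∀ n → ⌊ n + 2 /2⌋ ≡ suc ⌊ n /2⌋
⌊n+2/2⌋ n = cong ⌊_/2⌋ (ℕₚ.+-comm n 2)

conc-bent⇔ : ∀ {n} (g₁ g₂ g₃ g₄ : BF n) → Bent g₁ → Bent g₂ → Bent g₃ → Bent g₄ →
  Bent (conc g₁ g₂ g₃ g₄) ⇔ (∀ u → dual g₁ u xor dual g₂ u xor dual g₃ u ≡ not (dual g₄ u))
conc-bent⇔ {n} g₁ g₂ g₃ g₄ b₁ b₂ b₃ b₄ = mk⇔
  (λ bent u → to (bent-select⇔ (dual g₁ u) (dual g₂ u) (dual g₃ u) (dual g₄ u))
                   (λ v → to (at u v) (bent (u ++ v))))
  (λ odd → elim-++ (λ u v → from (at u v)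
                      (from (bent-select⇔ (dual g₁ u) (dual g₂ u) (dual g₃ u) (dual g₄ u)) (odd u) v)))
  where
  at : ∀ u v → walsh (conc g₁ g₂ g₃ g₄) (u ++ v) ≡± 2 ^ ⌊ n + 2 /2⌋ ⇔ walsh (duals g₁ g₂ g₃ g₄ u) v ≡± 2
  at u v =
    subst (λ k → walsh (conc g₁ g₂ g₃ g₄) (u ++ v) ≡± 2 ^ k ⇔ walsh (duals g₁ g₂ g₃ g₄ u) v ≡± 2)
      (sym (⌊n+2/2⌋ n))
      (subst (λ w → w ≡± 2 ^ suc ⌊ n /2⌋ ⇔ walsh (duals g₁ g₂ g₃ g₄ u) v ≡± 2)
        (sym (walsh-conc-bent {g₁ = g₁} {g₂} {g₃} {g₄} b₁ b₂ b₃ b₄ u v))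
        (≡±-*-cancelʳ 2 (2 ^ ⌊ n /2⌋) {{ℕₚ.m^n≢0 2 ⌊ n /2⌋}}))

proposition5 : (m : ℕ) (f₁ q₂ q₃ s : BF (2 * m)) →
    HomCubic f₁ → Bent f₁ → HomQuadratic q₂ → HomQuadratic q₃ →
    Bent (f₁ ⊕ q₂) → Bent (f₁ ⊕ q₃) →
    Bent (f₁ ⊕ (f₁ ⊕ q₂) ⊕ (f₁ ⊕ q₃)) →
    ((HomCubic (conc f₁ (f₁ ⊕ q₂) (f₁ ⊕ q₃) (f₁ ⊕ (f₁ ⊕ q₂) ⊕ (f₁ ⊕ q₃) ⊕ s))
       × Bent (conc f₁ (f₁ ⊕ q₂) (f₁ ⊕ q₃) (f₁ ⊕ (f₁ ⊕ q₂) ⊕ (f₁ ⊕ q₃) ⊕ s)))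
     ⇔ (Linear s ×
        (∀ (u : Vec Bool (2 * m)) →
           (dual f₁ u xor dual (f₁ ⊕ q₂) u xor dual (f₁ ⊕ q₃) u)
             ≡ not (dual (f₁ ⊕ (f₁ ⊕ q₂) ⊕ (f₁ ⊕ q₃) ⊕ s) u))))
proposition5 m f₁ q₂ q₃ s cubic-f₁ bent-f₁ quadratic-q₂ quadratic-q₃ bent-f₂ bent-f₃ bent-f₁₂₃ = mk⇔
  (λ (cubic , bent) → let linear = linear-s cubic in linear , to (bent⇔duals linear) bent)
  (λ (linear , odd) → cubic-conc linear , from (bent⇔duals linear) odd)
  where
  f₁₂₃ : BF (2 * m)
  f₁₂₃ = f₁ ⊕ (f₁ ⊕ q₂) ⊕ (f₁ ⊕ q₃)

  bent⇔duals : Linear s → Bent (conc f₁ (f₁ ⊕ q₂) (f₁ ⊕ q₃) (f₁₂₃ ⊕ s))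
    ⇔ (∀ u → dual f₁ u xor dual (f₁ ⊕ q₂) u xor dual (f₁ ⊕ q₃) u ≡ not (dual (f₁₂₃ ⊕ s) u))
  bent⇔duals linear =
    conc-bent⇔ f₁ (f₁ ⊕ q₂) (f₁ ⊕ q₃) (f₁₂₃ ⊕ s) bent-f₁ bent-f₂ bent-f₃
      (bent-⊕-linear {h = f₁₂₃} bent-f₁₂₃ linear)

  linear-s : HomCubic (conc f₁ (f₁ ⊕ q₂) (f₁ ⊕ q₃) (f₁₂₃ ⊕ s)) → Linear s
  linear-s cubic = homogeneous₁⇒linear
    (homogeneous-cong (λ z → xor-cancelˡ (f₁₂₃ z) (s z))
      (homogeneous-conc⇒corner f₁ (f₁ ⊕ q₂) (f₁ ⊕ q₃) (f₁₂₃ ⊕ s) cubic))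

  cubic-conc : Linear s → HomCubic (conc f₁ (f₁ ⊕ q₂) (f₁ ⊕ q₃) (f₁₂₃ ⊕ s))
  cubic-conc linear = homogeneous-conc {d = 1} cubic-f₁
    (homogeneous-cong (λ z → sym (xor-cancelˡ (f₁ z) (q₂ z))) quadratic-q₂)
    (homogeneous-cong (λ z → sym (xor-cancelˡ (f₁ z) (q₃ z))) quadratic-q₃)
    (homogeneous-cong (λ z → sym (xor-cancelˡ (f₁₂₃ z) (s z))) (linear⇒homogeneous₁ linear))
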